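{- Let $d,k,\ell,r\in\mathbb{Z}^+$ with $d \geq 2$. For every $r$-coloring of the points of $\left(\mathbb{Z}^+\right)^d$ there exist points $\mathbf{p}_1,\dots,\mathbf{p}_k,\mathbf{q}_1,\dots,\mathbf{q}_\ell\in\left(\mathbb{Z}^+\right)^d$, all of the same color, such that $$\sum_{i=1}^{k}\mathbf{p}_i = \sum_{i=1}^{\ell}\mathbf{q}_i,$$ and moreover: if $d \leq k-1$ then $\mathbf{p}_1, \mathbf{p}_2,\dots, \mathbf{p}_d$ are linearly independent over $\mathbb{Q}$; if $d \leq \ell-1$ then $\mathbf{q}_1, \mathbf{q}_2,\dots, \mathbf{q}_d$ are linearly independent over $\mathbb{Q}$; and $\{\mathbf{p}_1, \dots, \mathbf{p}_{k-1}\} \cap \{\mathbf{q}_1,\dots, \mathbf{q}_{\ell-1}\} = \emptyset$. -}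

module Defs where

open import Data.Nat as ℕ using (ℕ; zero; suc)
open import Data.Fin using (Fin; zero; suc)
open import Data.Integer using (+_)
open import Data.Rational as ℚ using (ℚ; 0ℚ; _/_)
open import Relation.Binary.PropositionalEquality using (_≡_)

-- A point of ℤ^d (we use ℕ-valued coordinates; positivity imposed separately)
Point : ℕ → Set
Point d = Fin d → ℕ

Positive : ∀ {d} → Point d → Set
Positive {d} x = ∀ (t : Fin d) → 1 ℕ.≤ x t

sumℕ : ∀ {n} → (Fin n → ℕ) → ℕ
sumℕ {zero}  f = 0
sumℕ {suc n} f = f zero ℕ.+ sumℕ (λ i → f (suc i))

sumℚ : ∀ {n} → (Fin n → ℚ) → ℚ
sumℚ {zero}  f = 0ℚ
sumℚ {suc n} f = f zero ℚ.+ sumℚ (λ i → f (suc i))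

toℚ : ℕ → ℚ
toℚ n = + n / 1

LinIndepℚ : ∀ {m d} → (Fin m → Point d) → Set
LinIndepℚ {m} {d} v =
  (a : Fin m → ℚ) →
  (∀ (t : Fin d) → sumℚ (λ j → a j ℚ.* toℚ (v j t)) ≡ 0ℚ) →
  ∀ (j : Fin m) → a j ≡ 0ℚ

_≐_ : ∀ {d} → Point d → Point d → Set
_≐_ {d} x y = ∀ (t : Fin d) → x t ≡ y t

{-# OPTIONS --safe #-}
-- Colour each pair u < w by the colour of the chord γ w − γ u of the moment curve
-- γ x = (x, x², …, x^d).  Ramsey's theorem for pairs gives b₀ < b₁ < … < b_M with
-- M = 2 (k + ℓ) all of whose chords have the same colour.  The pᵢ are the chords of
-- the polygon through b₀, b₂, b₄, …, b_{2k−2}, b_M and the qⱼ those of the polygon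
-- through b₀, b₁, b₃, …, b_{2ℓ−3}, b_M, so both sums telescope to γ b_M − γ b₀.
-- Consecutive chords of the moment curve are linearly independent (summation by
-- parts turns a dependence into a Vandermonde system), and a chord determines its
-- endpoint, so an interior p-chord, which ends at an even-indexed vertex, is never
-- a q-chord, which ends at an odd-indexed one.
module Submission where

open import Defs
open import Data.Nat using (ℕ; _≤_; _<_; _∸_; suc)
open import Data.Fin using (Fin; toℕ)
open import Data.Product using (Σ; _×_)
open import Relation.Nullary using (¬_)
open import Relation.Binary.PropositionalEquality using (_≡_)

open import Data.Nat using (zero; z≤n; s≤s; z<s; s<s)
import Data.Nat as ℕ
open import Data.Fin using (zero; suc; fromℕ<)
open import Data.Fin.Properties using (toℕ<n; toℕ-fromℕ<; toℕ-injective; 0≢1+n)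
open import Data.Product using (_,_)
open import Function using (_∘_; Injective)
open import Relation.Binary.Definitions using (tri<; tri≈; tri>)
open import Relation.Nullary using (contradiction)
open import Relation.Binary.PropositionalEquality
  using (_≢_; refl; sym; trans; cong; cong₂; subst; module ≡-Reasoning)
open ≡-Reasoning

IncreasingUpTo : ℕ → (ℕ → ℕ) → Set
IncreasingUpTo n x = ∀ {i j} → i < j → j ≤ n → x i < x j

-- γ w − γ u, with truncated subtraction: the true difference only when u ≤ w.
chord : ∀ {d} → ℕ → ℕ → Point d
chord u w t = w ℕ.^ suc (toℕ t) ∸ u ℕ.^ suc (toℕ t)

chords : ∀ {n d} → (ℕ → ℕ) → Fin n → Point d
chords x i = chord (x (toℕ i)) (x (suc (toℕ i)))

module _ where
  open import Data.Nat using (_+_; _*_; _^_; >-nonZero)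
  open import Data.Nat.Properties
  open import Data.Nat.Solver using (module +-*-Solver)
  open +-*-Solver using (solve; _:=_; _:+_; _:*_; _:^_; con)

  increasing⇒injective : ∀ {n x} → IncreasingUpTo n x → ∀ {i j} → i ≤ n → j ≤ n → x i ≡ x j → i ≡ j
  increasing⇒injective x↑ {i} {j} i≤n j≤n xi≡xj with <-cmp i j
  ... | tri< i<j _ _ = contradiction xi≡xj (<⇒≢ (x↑ i<j j≤n))
  ... | tri≈ _ i≡j _ = i≡j
  ... | tri> _ _ j<i = contradiction (sym xi≡xj) (<⇒≢ (x↑ j<i i≤n))

  chord-positive : ∀ {d u w} → u < w → Positive {d} (chord u w)
  chord-positive u<w t = m<n⇒0<n∸m (^-monoˡ-< (suc (toℕ t)) u<w)

  chords-positive : ∀ {n d x} → IncreasingUpTo n x → ∀ i → Positive {d} (chords x i)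
  chords-positive x↑ i = chord-positive (x↑ (n<1+n _) (toℕ<n i))

  telescope : ∀ n (h : ℕ → ℕ) → (∀ i → i < n → h i ≤ h (suc i)) →
    sumℕ {n} (λ i → h (suc (toℕ i)) ∸ h (toℕ i)) + h 0 ≡ h n
  telescope zero    h _  = refl
  telescope (suc n) h h↑ = begin
    (h 1 ∸ h 0 + S) + h 0   ≡⟨ cong (_+ h 0) (+-comm (h 1 ∸ h 0) S) ⟩
    (S + (h 1 ∸ h 0)) + h 0 ≡⟨ +-assoc S (h 1 ∸ h 0) (h 0) ⟩
    S + (h 1 ∸ h 0 + h 0)   ≡⟨ cong (S +_) (m∸n+n≡m (h↑ 0 z<s)) ⟩
    S + h 1                 ≡⟨ telescope n (h ∘ suc) (λ i i<n → h↑ (suc i) (s<s i<n)) ⟩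
    h (suc n)               ∎
    where S = sumℕ {n} (λ i → h (suc (suc (toℕ i))) ∸ h (suc (toℕ i)))

  chords-sum : ∀ {n d x} → IncreasingUpTo n x → (t : Fin d) →
    sumℕ (λ i → chords {n} x i t) ≡ chord (x 0) (x n) t
  chords-sum {n} {x = x} x↑ t = begin
    S                        ≡⟨ m+n∸n≡m S (x 0 ^ e) ⟨
    S + x 0 ^ e ∸ x 0 ^ e    ≡⟨ cong (_∸ x 0 ^ e) (telescope n (λ j → x j ^ e) x^e↑) ⟩
    x n ^ e ∸ x 0 ^ e        ∎
    where
    e = suc (toℕ t)
    S = sumℕ (λ i → chords {n} x i t)
    x^e↑ : ∀ i → i < n → x i ^ e ≤ x (suc i) ^ e
    x^e↑ i i<n = ^-monoˡ-≤ e (<⇒≤ (x↑ (n<1+n i) i<n))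

  square-difference : ∀ u L → (u + L) ^ 2 ∸ u ^ 2 ≡ L * (2 * u + L)
  square-difference u L = trans (cong (_∸ u ^ 2) expand) (m+n∸m≡n (u ^ 2) (L * (2 * u + L)))
    where
    expand : (u + L) ^ 2 ≡ u ^ 2 + L * (2 * u + L)
    expand = solve 2 (λ u L → (u :+ L) :^ 2 := u :^ 2 :+ L :* (con 2 :* u :+ L)) refl u L

  -- Already w − u and w² − u² determine w: for fixed L = w − u > 0 the map
  -- u ↦ (u + L)² − u² = L (2u + L) is injective.
  chord-injectiveʳ : ∀ {d u w u′ w′} → u < w → u′ < w′ → chord {suc (suc d)} u w ≐ chord u′ w′ → w ≡ w′
  chord-injectiveʳ {u = u} {w} {u′} {w′} u<w u′<w′ same = begin
    w         ≡⟨ w≡u+L ⟩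
    u + L     ≡⟨ cong (_+ L) u≡u′ ⟩
    u′ + L    ≡⟨ w′≡u′+L ⟨
    w′        ∎
    where
    L = w ∸ u
    instance _ = >-nonZero (m<n⇒0<n∸m u<w)
    L≡w′∸u′ : L ≡ w′ ∸ u′
    L≡w′∸u′ = begin
      w ∸ u             ≡⟨ cong₂ _∸_ (*-identityʳ w) (*-identityʳ u) ⟨
      w ^ 1 ∸ u ^ 1     ≡⟨ same zero ⟩
      w′ ^ 1 ∸ u′ ^ 1   ≡⟨ cong₂ _∸_ (*-identityʳ w′) (*-identityʳ u′) ⟩
      w′ ∸ u′           ∎
    w≡u+L : w ≡ u + L
    w≡u+L = sym (m+[n∸m]≡n (<⇒≤ u<w))
    w′≡u′+L : w′ ≡ u′ + L
    w′≡u′+L = trans (sym (m+[n∸m]≡n (<⇒≤ u′<w′))) (cong (u′ +_) (sym L≡w′∸u′))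
    u≡u′ : u ≡ u′
    u≡u′ = *-cancelˡ-≡ u u′ 2 (+-cancelʳ-≡ L (2 * u) (2 * u′) (*-cancelˡ-≡ _ _ L (begin
      L * (2 * u + L)           ≡⟨ square-difference u L ⟨
      (u + L) ^ 2 ∸ u ^ 2       ≡⟨ cong (λ z → z ^ 2 ∸ u ^ 2) w≡u+L ⟨
      w ^ 2 ∸ u ^ 2             ≡⟨ same (suc zero) ⟩
      w′ ^ 2 ∸ u′ ^ 2           ≡⟨ cong (λ z → z ^ 2 ∸ u′ ^ 2) w′≡u′+L ⟩
      (u′ + L) ^ 2 ∸ u′ ^ 2     ≡⟨ square-difference u′ L ⟩
      L * (2 * u′ + L)          ∎)))

module _ where
  import Data.Nat.Properties as ℕ
  import Data.Integer as ℤ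
  import Data.Integer.Properties as ℤ
  open import Data.Nat.Coprimality using (1-coprimeTo) renaming (sym to coprime-sym)
  open import Data.Fin.Properties using (suc-injective)
  open import Data.Rational using (ℚ; mkℚ; ↥_; 0ℚ; 1ℚ; _/_; _+_; _*_; _-_; 1/_; ≢-nonZero)
  open import Data.Rational.Properties
    using (normalize-coprime; +-identityʳ; *-identityʳ; *-zeroˡ; *-assoc; *-inverseʳ;
           +-0-group; +-*-rawSemiring)
  open import Algebra.Properties.Group +-0-group using (x∙y⁻¹≈ε⇒x≈y)
  open import Algebra.Definitions.RawSemiring +-*-rawSemiring using (_^_)
  open import Data.Rational.Solver using (module +-*-Solver)
  open +-*-Solver using (solve; _:=_; _:+_; _:-_; _:*_; con)

  toℚ≡mkℚ : ∀ n → toℚ n ≡ mkℚ (ℤ.+ n) 0 (coprime-sym (1-coprimeTo n))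
  toℚ≡mkℚ n = normalize-coprime _

  toℚ-injective : ∀ {m n} → toℚ m ≡ toℚ n → m ≡ n
  toℚ-injective {m} {n} eq = ℤ.+-injective (begin
    ℤ.+ m     ≡⟨ cong ↥_ (toℚ≡mkℚ m) ⟨
    ↥ toℚ m   ≡⟨ cong ↥_ eq ⟩
    ↥ toℚ n   ≡⟨ cong ↥_ (toℚ≡mkℚ n) ⟩
    ℤ.+ n     ∎)

  -- On the normal forms mkℚ (+ n) 0 _, ℚ's _+_ and _*_ reduce to a numerator over 1;
  -- this is the second step of the next two proofs.
  toℚ-+ : ∀ m n → toℚ (m ℕ.+ n) ≡ toℚ m + toℚ n
  toℚ-+ m n = begin
    ℤ.+ (m ℕ.+ n) / 1                           ≡⟨ cong (_/ 1) numerator ⟩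
    (ℤ.+ m ℤ.* ℤ.+ 1 ℤ.+ ℤ.+ n ℤ.* ℤ.+ 1) / 1   ≡⟨ cong₂ _+_ (toℚ≡mkℚ m) (toℚ≡mkℚ n) ⟨
    toℚ m + toℚ n                               ∎
    where
    numerator : ℤ.+ (m ℕ.+ n) ≡ ℤ.+ m ℤ.* ℤ.+ 1 ℤ.+ ℤ.+ n ℤ.* ℤ.+ 1
    numerator = trans (ℤ.pos-+ m n) (sym (cong₂ ℤ._+_ (ℤ.*-identityʳ (ℤ.+ m)) (ℤ.*-identityʳ (ℤ.+ n))))

  toℚ-* : ∀ m n → toℚ (m ℕ.* n) ≡ toℚ m * toℚ n
  toℚ-* m n = begin
    ℤ.+ (m ℕ.* n) / 1       ≡⟨ cong (_/ 1) (ℤ.pos-* m n) ⟩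
    (ℤ.+ m ℤ.* ℤ.+ n) / 1   ≡⟨ cong₂ _*_ (toℚ≡mkℚ m) (toℚ≡mkℚ n) ⟨
    toℚ m * toℚ n           ∎

  toℚ-∸ : ∀ {m n} → n ≤ m → toℚ (m ∸ n) ≡ toℚ m - toℚ n
  toℚ-∸ {m} {n} n≤m = begin
    toℚ (m ∸ n)                      ≡⟨ solve 2 (λ x y → x := (x :+ y) :- y) refl (toℚ (m ∸ n)) (toℚ n) ⟩
    (toℚ (m ∸ n) + toℚ n) - toℚ n    ≡⟨ cong (_- toℚ n) (toℚ-+ (m ∸ n) n) ⟨
    toℚ (m ∸ n ℕ.+ n) - toℚ n        ≡⟨ cong (λ z → toℚ z - toℚ n) (ℕ.m∸n+n≡m n≤m) ⟩
    toℚ m - toℚ n                    ∎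

  toℚ-^ : ∀ m e → toℚ (m ℕ.^ e) ≡ toℚ m ^ e
  toℚ-^ m zero    = refl
  toℚ-^ m (suc e) = trans (toℚ-* m (m ℕ.^ e)) (cong (toℚ m *_) (toℚ-^ m e))

  x*y≡0⇒x≡0 : ∀ {x y} → y ≢ 0ℚ → x * y ≡ 0ℚ → x ≡ 0ℚ
  x*y≡0⇒x≡0 {x} {y} y≢0 xy≡0 = begin
    x                  ≡⟨ *-identityʳ x ⟨
    x * 1ℚ             ≡⟨ cong (x *_) (*-inverseʳ y) ⟨
    x * (y * 1/ y)     ≡⟨ *-assoc x y (1/ y) ⟨
    x * y * 1/ y       ≡⟨ cong (_* 1/ y) xy≡0 ⟩
    0ℚ * 1/ y          ≡⟨ *-zeroˡ (1/ y) ⟩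
    0ℚ                 ∎
    where instance _ = ≢-nonZero y≢0

  sumℚ-cong : ∀ {n} {f g : Fin n → ℚ} → (∀ i → f i ≡ g i) → sumℚ f ≡ sumℚ g
  sumℚ-cong {zero}  f≗g = refl
  sumℚ-cong {suc n} f≗g = cong₂ _+_ (f≗g zero) (sumℚ-cong (f≗g ∘ suc))

  sumℚ-zero : ∀ {n} {f : Fin n → ℚ} → (∀ i → f i ≡ 0ℚ) → sumℚ f ≡ 0ℚ
  sumℚ-zero {zero}  f≗0 = refl
  sumℚ-zero {suc n} f≗0 = trans (cong₂ _+_ (f≗0 zero) (sumℚ-zero (f≗0 ∘ suc))) (+-identityʳ 0ℚ)

  sumℚ-linear : ∀ {n} (f g : Fin n → ℚ) c → sumℚ (λ i → f i - c * g i) ≡ sumℚ f - c * sumℚ g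
  sumℚ-linear {zero}  f g c = solve 1 (λ c → con 0ℚ := con 0ℚ :- c :* con 0ℚ) refl c
  sumℚ-linear {suc n} f g c = begin
    (f zero - c * g zero) + sumℚ (λ i → f (suc i) - c * g (suc i))
      ≡⟨ cong (λ s → (f zero - c * g zero) + s) (sumℚ-linear (f ∘ suc) (g ∘ suc) c) ⟩
    (f zero - c * g zero) + (sumℚ (f ∘ suc) - c * sumℚ (g ∘ suc))
      ≡⟨ solve 5 (λ a b c u v → (a :- c :* b) :+ (u :- c :* v) := (a :+ u) :- c :* (b :+ v)) refl
           (f zero) (g zero) c (sumℚ (f ∘ suc)) (sumℚ (g ∘ suc)) ⟩
    (f zero + sumℚ (f ∘ suc)) - c * (g zero + sumℚ (g ∘ suc)) ∎

  vandermonde : ∀ {n} (X B : Fin n → ℚ) → Injective _≡_ _≡_ X →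
    (∀ t → t ℕ.< n → sumℚ (λ j → B j * X j ^ t) ≡ 0ℚ) → ∀ j → B j ≡ 0ℚ
  vandermonde {suc n} X B X-inj moments = λ { zero → B₀≡0 ; (suc j) → Bₛ≡0 j }
    where
    C : Fin n → ℚ
    C j = B (suc j) * (X (suc j) - X zero)

    C-moments : ∀ t → t ℕ.< n → sumℚ (λ j → C j * X (suc j) ^ t) ≡ 0ℚ
    C-moments t t<n = begin
      sumℚ (λ j → C j * X (suc j) ^ t)
        ≡⟨ solve 4 (λ b x p s → s := b :* (x :- x) :* p :+ s) refl
             (B zero) (X zero) (X zero ^ t) (sumℚ (λ j → C j * X (suc j) ^ t)) ⟩
      sumℚ (λ j → B j * (X j - X zero) * X j ^ t)
        ≡⟨ sumℚ-cong (λ j → solve 4 (λ b x y p → b :* (x :- y) :* p := b :* (x :* p) :- y :* (b :* p)) refl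
             (B j) (X j) (X zero) (X j ^ t)) ⟩
      sumℚ (λ j → B j * X j ^ suc t - X zero * (B j * X j ^ t))
        ≡⟨ sumℚ-linear (λ j → B j * X j ^ suc t) (λ j → B j * X j ^ t) (X zero) ⟩
      sumℚ (λ j → B j * X j ^ suc t) - X zero * sumℚ (λ j → B j * X j ^ t)
        ≡⟨ cong₂ (λ u v → u - X zero * v) (moments (suc t) (s≤s t<n)) (moments t (ℕ.m<n⇒m<1+n t<n)) ⟩
      0ℚ - X zero * 0ℚ
        ≡⟨ solve 1 (λ x → con 0ℚ :- x :* con 0ℚ := con 0ℚ) refl (X zero) ⟩
      0ℚ ∎

    Bₛ≡0 : ∀ j → B (suc j) ≡ 0ℚ
    Bₛ≡0 j = x*y≡0⇒x≡0 (λ difference≡0 → 0≢1+n (X-inj (sym (x∙y⁻¹≈ε⇒x≈y _ _ difference≡0))))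
      (vandermonde (X ∘ suc) C (suc-injective ∘ X-inj) C-moments j)

    B₀≡0 : B zero ≡ 0ℚ
    B₀≡0 = begin
      B zero                       ≡⟨ solve 1 (λ b → b := b :* con 1ℚ :+ con 0ℚ) refl (B zero) ⟩
      B zero * 1ℚ + 0ℚ             ≡⟨ cong (λ s → B zero * 1ℚ + s) tail≡0 ⟨
      sumℚ (λ j → B j * X j ^ 0)   ≡⟨ moments 0 (s≤s z≤n) ⟩
      0ℚ                           ∎
      where tail≡0 = sumℚ-zero (λ j → trans (*-identityʳ _) (Bₛ≡0 j))

  sumℚ< : ℕ → (ℕ → ℚ) → ℚ
  sumℚ< n f = sumℚ {n} (λ j → f (toℕ j))

  Δ : (ℕ → ℚ) → ℕ → ℚ
  Δ A zero    = 0ℚ - A 0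
  Δ A (suc j) = A j - A (suc j)

  summation-by-parts : ∀ d (A Y : ℕ → ℚ) → A d ≡ 0ℚ →
    sumℚ< d (λ s → A s * (Y (suc s) - Y s)) ≡ sumℚ< (suc d) (λ j → Δ A j * Y j)
  summation-by-parts zero A Y A₀≡0 = begin
    0ℚ                          ≡⟨ solve 1 (λ y → con 0ℚ := (con 0ℚ :- con 0ℚ) :* y :+ con 0ℚ) refl (Y 0) ⟩
    (0ℚ - 0ℚ) * Y 0 + 0ℚ        ≡⟨ cong (λ a → (0ℚ - a) * Y 0 + 0ℚ) A₀≡0 ⟨
    (0ℚ - A 0) * Y 0 + 0ℚ       ∎
  summation-by-parts (suc d) A Y A-end≡0 = begin
    A 0 * (Y 1 - Y 0) + sumℚ< d (λ s → A (suc s) * (Y (suc (suc s)) - Y (suc s)))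
      ≡⟨ cong (λ s → A 0 * (Y 1 - Y 0) + s) (summation-by-parts d (A ∘ suc) (Y ∘ suc) A-end≡0) ⟩
    A 0 * (Y 1 - Y 0) + ((0ℚ - A 1) * Y 1 + R)
      ≡⟨ solve 5 (λ a₀ a₁ y₀ y₁ r → a₀ :* (y₁ :- y₀) :+ ((con 0ℚ :- a₁) :* y₁ :+ r)
                                  := (con 0ℚ :- a₀) :* y₀ :+ ((a₀ :- a₁) :* y₁ :+ r)) refl
           (A 0) (A 1) (Y 0) (Y 1) R ⟩
    (0ℚ - A 0) * Y 0 + ((A 0 - A 1) * Y 1 + R) ∎
    where R = sumℚ< d (λ j → Δ A (suc (suc j)) * Y (suc (suc j)))

  -- A d occurs in no sum; the normalisation A d ≡ 0 makes Δ A the coefficient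
  -- sequence produced by summation by parts.
  momentChords-independent : ∀ d (X : ℕ → ℚ) → (∀ {i j} → i ℕ.≤ d → j ℕ.≤ d → X i ≡ X j → i ≡ j) →
    (A : ℕ → ℚ) → A d ≡ 0ℚ →
    (∀ t → t ℕ.< d → sumℚ< d (λ s → A s * (X (suc s) ^ suc t - X s ^ suc t)) ≡ 0ℚ) →
    ∀ s → s ℕ.< d → A s ≡ 0ℚ
  momentChords-independent d X X-inj A A-end≡0 vanish = A≡0
    where
    moments : ∀ e → e ℕ.< suc d → sumℚ< (suc d) (λ j → Δ A j * X j ^ e) ≡ 0ℚ
    moments zero    _         = trans (sym (summation-by-parts d A (λ j → X j ^ 0) A-end≡0))
      (sumℚ-zero {d} (λ s → solve 1 (λ a → a :* (con 1ℚ :- con 1ℚ) := con 0ℚ) refl (A (toℕ s))))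
    moments (suc t) (s≤s t<d) =
      trans (sym (summation-by-parts d A (λ j → X j ^ suc t) A-end≡0)) (vanish t t<d)

    Δ≡0 : ∀ j → j ℕ.≤ d → Δ A j ≡ 0ℚ
    Δ≡0 j j≤d = subst (λ i → Δ A i ≡ 0ℚ) (toℕ-fromℕ< (s≤s j≤d))
      (vandermonde (X ∘ toℕ) (Δ A ∘ toℕ) X∘toℕ-injective moments (fromℕ< (s≤s j≤d)))
      where
      X∘toℕ-injective : Injective _≡_ _≡_ (X ∘ toℕ {suc d})
      X∘toℕ-injective {i} {j} = toℕ-injective ∘ X-inj (ℕ.≤-pred (toℕ<n i)) (ℕ.≤-pred (toℕ<n j))

    A≡0 : ∀ s → s ℕ.< d → A s ≡ 0ℚ
    A≡0 zero    _   = sym (x∙y⁻¹≈ε⇒x≈y 0ℚ (A 0) (Δ≡0 0 z≤n))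
    A≡0 (suc s) s<d = trans (sym (x∙y⁻¹≈ε⇒x≈y (A s) (A (suc s)) (Δ≡0 (suc s) (ℕ.<⇒≤ s<d))))
                            (A≡0 s (ℕ.<-trans (ℕ.n<1+n s) s<d))

  toℚ-chord : ∀ {d u w} → u ℕ.≤ w → (t : Fin d) →
    toℚ (chord u w t) ≡ toℚ w ^ suc (toℕ t) - toℚ u ^ suc (toℕ t)
  toℚ-chord {u = u} {w} u≤w t =
    trans (toℚ-∸ (ℕ.^-monoˡ-≤ e u≤w)) (cong₂ _-_ (toℚ-^ w e) (toℚ-^ u e))
    where e = suc (toℕ t)

  padZero : ∀ {d} → (Fin d → ℚ) → ℕ → ℚ
  padZero {zero}  a _       = 0ℚ
  padZero {suc d} a zero    = a zero
  padZero {suc d} a (suc j) = padZero (a ∘ suc) j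

  padZero-toℕ : ∀ {d} (a : Fin d → ℚ) s → padZero a (toℕ s) ≡ a s
  padZero-toℕ a zero    = refl
  padZero-toℕ a (suc s) = padZero-toℕ (a ∘ suc) s

  padZero-end : ∀ {d} (a : Fin d → ℚ) → padZero a d ≡ 0ℚ
  padZero-end {zero}  a = refl
  padZero-end {suc d} a = padZero-end (a ∘ suc)

  chords-independent : ∀ {d x} → IncreasingUpTo d x → LinIndepℚ (chords {d} {d} x)
  chords-independent {d} {x} x↑ a vanish s = begin
    a s                  ≡⟨ padZero-toℕ a s ⟨
    padZero a (toℕ s)    ≡⟨ momentChords-independent d X X-injective (padZero a) (padZero-end a) vanish′
                                                         (toℕ s) (toℕ<n s) ⟩
    0ℚ                   ∎
    where
    X : ℕ → ℚ
    X = toℚ ∘ x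
    X-injective : ∀ {i j} → i ℕ.≤ d → j ℕ.≤ d → X i ≡ X j → i ≡ j
    X-injective i≤d j≤d = increasing⇒injective x↑ i≤d j≤d ∘ toℚ-injective
    vanish′ : ∀ t → t ℕ.< d → sumℚ< d (λ s → padZero a s * (X (suc s) ^ suc t - X s ^ suc t)) ≡ 0ℚ
    vanish′ t t<d = trans (sumℚ-cong term) (vanish (fromℕ< t<d))
      where
      term : ∀ s → padZero a (toℕ s) * (X (suc (toℕ s)) ^ suc t - X (toℕ s) ^ suc t)
                 ≡ a s * toℚ (chords x s (fromℕ< t<d))
      term s = cong₂ _*_ (padZero-toℕ a s) (begin
        X (suc (toℕ s)) ^ suc t - X (toℕ s) ^ suc t
          ≡⟨ cong (λ e → X (suc (toℕ s)) ^ suc e - X (toℕ s) ^ suc e) (toℕ-fromℕ< t<d) ⟨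
        X (suc (toℕ s)) ^ suc (toℕ (fromℕ< t<d)) - X (toℕ s) ^ suc (toℕ (fromℕ< t<d))
          ≡⟨ toℚ-chord (ℕ.<⇒≤ (x↑ (ℕ.n<1+n _) (toℕ<n s))) (fromℕ< t<d) ⟨
        toℚ (chords x s (fromℕ< t<d)) ∎)

  LinIndepℚ-resp-≐ : ∀ {m d} {v w : Fin m → Point d} → (∀ s → v s ≐ w s) → LinIndepℚ w → LinIndepℚ v
  LinIndepℚ-resp-≐ v≐w w-independent a vanish =
    w-independent a (λ t → trans (sumℚ-cong (λ s → cong (λ z → a s * toℚ z) (sym (v≐w s t)))) (vanish t))

  chords-prefix-independent : ∀ {d n x} → d ℕ.≤ n → IncreasingUpTo n x →
    (f : Fin d → Fin n) → (∀ s → toℕ (f s) ≡ toℕ s) → LinIndepℚ (λ s → chords {n} {d} x (f s))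
  chords-prefix-independent {x = x} d≤n x↑ f f≗id = LinIndepℚ-resp-≐
    (λ s t → cong (λ i → chord (x i) (x (suc i)) t) (f≗id s))
    (chords-independent (λ i<j j≤d → x↑ i<j (ℕ.≤-trans j≤d d≤n)))

open import Data.Nat using (_+_; _*_; _<?_)
open import Data.Product using (proj₁; proj₂; ∃; ∃₂)
open import Function using (id)
open import Relation.Nullary using (yes; no)

record Homogeneous {r} (χ : ℕ → ℕ → Fin r) (M : ℕ) : Set where
  field
    colour        : Fin r
    point         : ℕ → ℕ
    increasing    : IncreasingUpTo M point
    monochromatic : ∀ {x y} → x < y → y ≤ M → χ (point x) (point y) ≡ colour

module _ where
  open import Data.Nat using (_≤?_)
  open import Data.Nat.Properties
  import Data.Fin.Properties as Fin
  open import Data.List using (List; []; _∷_; length; filter; map; upTo)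
  open import Data.List.Properties using (filter-accept; filter-reject; length-map; length-upTo)
  open import Data.List.Relation.Unary.All as All using (All; []; _∷_)
  open import Data.List.Relation.Unary.All.Properties using (all-filter; anti-mono)
    renaming (filter⁺ to All-filter⁺; map⁻ to All-map⁻)
  open import Data.List.Relation.Unary.AllPairs using (AllPairs; []; _∷_)
  import Data.List.Relation.Unary.AllPairs.Properties as AllPairs
  open import Data.List.Relation.Binary.Subset.Propositional using (_⊆_)
  open import Data.List.Relation.Binary.Subset.Propositional.Properties using (⊆-trans; filter-⊆; ∷⁺ʳ)

  sumℕ-cong : ∀ {n} {f g : Fin n → ℕ} → (∀ i → f i ≡ g i) → sumℕ f ≡ sumℕ g
  sumℕ-cong {zero}  f≗g = refl
  sumℕ-cong {suc n} f≗g = cong₂ _+_ (f≗g zero) (sumℕ-cong (f≗g ∘ suc))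

  sumℕ-zero : ∀ n → sumℕ {n} (λ _ → 0) ≡ 0
  sumℕ-zero zero    = refl
  sumℕ-zero (suc n) = sumℕ-zero n

  sumℕ-suc-at : ∀ {n} (j : Fin n) {f g : Fin n → ℕ} → g j ≡ suc (f j) → (∀ i → j ≢ i → g i ≡ f i) →
    sumℕ g ≡ suc (sumℕ f)
  sumℕ-suc-at zero    gj others = cong₂ _+_ gj (sumℕ-cong (λ i → others (suc i) Fin.0≢1+n))
  sumℕ-suc-at (suc j) gj others = trans
    (cong₂ _+_ (others zero (Fin.0≢1+n ∘ sym))
               (sumℕ-suc-at j gj (λ i j≢i → others (suc i) (j≢i ∘ Fin.suc-injective))))
    (+-suc _ _)

  sumℕ-< : ∀ {n m} {f : Fin (suc n) → ℕ} → (∀ i → f i < m) → sumℕ f < suc n * m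
  sumℕ-< {zero}  f<m = +-monoˡ-< 0 (f<m zero)
  sumℕ-< {suc n} f<m = +-mono-< (f<m zero) (sumℕ-< (f<m ∘ suc))

  class : ∀ {A : Set} {n} → (A → Fin n) → List A → Fin n → List A
  class h xs i = filter (λ x → h x Fin.≟ i) xs

  length-classes : ∀ {A : Set} {n} (h : A → Fin n) xs → sumℕ (λ i → length (class h xs i)) ≡ length xs
  length-classes {n = n} h [] = sumℕ-zero n
  length-classes h (x ∷ xs) = trans
    (sumℕ-suc-at (h x) (cong length (filter-accept (λ y → h y Fin.≟ h x) refl))
                       (λ i hx≢i → cong length (filter-reject (λ y → h y Fin.≟ i) hx≢i)))
    (cong suc (length-classes h xs))

  pigeonhole : ∀ {A : Set} {r m} (h : A → Fin (suc r)) xs → suc r * m ≤ length xs →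
    ∃ λ i → m ≤ length (class h xs i)
  pigeonhole {m = m} h xs long with Fin.any? (λ i → m ≤? length (class h xs i))
  ... | yes found = found
  ... | no  none  = contradiction (subst (_ ≤_) (sym (length-classes h xs)) long)
                                  (<⇒≱ (sumℕ-< (λ i → ≰⇒> (none ∘ (i ,_)))))

  nth : List ℕ → ℕ → ℕ
  nth []       _       = 0
  nth (x ∷ _)  zero    = x
  nth (_ ∷ xs) (suc i) = nth xs i

  All-nth : ∀ {P : ℕ → Set} {xs i} → All P xs → i < length xs → P (nth xs i)
  All-nth {i = zero}  (px ∷ _)  _         = px
  All-nth {i = suc i} (_ ∷ pxs) (s≤s i<n) = All-nth pxs i<n

  AllPairs-nth : ∀ {R : ℕ → ℕ → Set} {xs i j} → AllPairs R xs → i < j → j < length xs →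
    R (nth xs i) (nth xs j)
  AllPairs-nth {i = zero}  {suc j} (rx ∷ _)  _         (s≤s j<n) = All-nth rx j<n
  AllPairs-nth {i = suc i} {suc j} (_ ∷ rxs) (s≤s i<j) (s≤s j<n) = AllPairs-nth rxs i<j j<n

  module _ {r} (χ : ℕ → ℕ → Fin (suc r)) where

    Tagged : Set
    Tagged = ℕ × Fin (suc r)

    _⇝_ : Tagged → Tagged → Set
    x ⇝ y = proj₁ x < proj₁ y × χ (proj₁ x) (proj₁ y) ≡ proj₂ x

    greedyBound : ℕ → ℕ
    greedyBound zero    = 0
    greedyBound (suc g) = suc (suc r * greedyBound g)

    -- Tag the head a of L with the most frequent colour i of the pairs (a, b) and
    -- continue inside that colour class; each tagged a sees all later ones in its tag.
    greedy : ∀ g (L : List ℕ) → AllPairs _<_ L → greedyBound g ≤ length L →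
      ∃ λ T → length T ≡ g × AllPairs _⇝_ T × map proj₁ T ⊆ L
    greedy zero    _       _              _          = [] , refl , [] , λ ()
    greedy (suc g) (a ∷ L) (a<L ∷ sorted) (s≤s long) with pigeonhole (χ a) L long
    ... | i , big with greedy g (class (χ a) L i) (AllPairs.filter⁺ _ sorted) big
    ... | T , length-T , tagged , T⊆ =
      (a , i) ∷ T , cong suc length-T , All-map⁻ (anti-mono T⊆ seen) ∷ tagged ,
      ∷⁺ʳ a (⊆-trans T⊆ (filter-⊆ _ L))
      where
      seen : All (λ b → a < b × χ a b ≡ i) (class (χ a) L i)
      seen = All.zip (All-filter⁺ _ a<L , all-filter _ L)

    sameTag-monochromatic : ∀ col {T} → AllPairs _⇝_ T →
      AllPairs (λ u w → u < w × χ u w ≡ col) (map proj₁ (class proj₂ T col))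
    sameTag-monochromatic col {T} tagged =
      AllPairs.map⁺ (retag (all-filter _ T) (AllPairs.filter⁺ _ tagged))
      where
      retag : ∀ {F} → All (λ x → proj₂ x ≡ col) F → AllPairs _⇝_ F →
        AllPairs (λ x y → proj₁ x < proj₁ y × χ (proj₁ x) (proj₁ y) ≡ col) F
      retag []             []              = []
      retag (x≡col ∷ tags) (x⇝F ∷ tagged) =
        All.map (λ (x<y , χ≡x) → x<y , trans χ≡x x≡col) x⇝F ∷ retag tags tagged

    ramsey-list : ∀ M → ∃₂ λ col xs → M ≤ length xs × AllPairs (λ u w → u < w × χ u w ≡ col) xs
    ramsey-list M with greedy (suc r * M) (upTo N) (AllPairs.applyUpTo⁺₁ id N (λ i<j _ → i<j))
                              (≤-reflexive (sym (length-upTo N)))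
      where N = greedyBound (suc r * M)
    ... | T , length-T , tagged , _ with pigeonhole proj₂ T (≤-reflexive (sym length-T))
    ... | col , big =
      col , _ , subst (M ≤_) (sym (length-map proj₁ (class proj₂ T col))) big ,
      sameTag-monochromatic col tagged

  opaque
    ramsey : ∀ {r} (χ : ℕ → ℕ → Fin (suc r)) M → Homogeneous χ M
    ramsey χ M with ramsey-list χ (suc M)
    ... | col , xs , long , mono = record
      { colour        = col
      ; point         = nth xs
      ; increasing    = λ x<y y≤M → proj₁ (AllPairs-nth mono x<y (<-≤-trans (s≤s y≤M) long))
      ; monochromatic = λ x<y y≤M → proj₂ (AllPairs-nth mono x<y (<-≤-trans (s≤s y≤M) long))
      }

record Path (n M : ℕ) : Set where
  field
    index      : ℕ → ℕ
    start      : index 0 ≡ 0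
    end        : index n ≡ M
    increasing : IncreasingUpTo n index
    bounded    : ∀ j → index j ≤ M

capped : ℕ → ℕ → (ℕ → ℕ) → ℕ → ℕ
capped n M f j with j <? n
... | yes _ = f j
... | no  _ = M

oddIndex : ℕ → ℕ
oddIndex zero    = 0
oddIndex (suc j) = suc (2 * j)

module _ where
  open import Data.Nat.Properties

  capped-< : ∀ {n M f j} → j < n → capped n M f j ≡ f j
  capped-< {n} {j = j} j<n with j <? n
  ... | yes _   = refl
  ... | no  j≮n = contradiction j<n j≮n

  capped-≮ : ∀ {n M f j} → ¬ j < n → capped n M f j ≡ M
  capped-≮ {n} {j = j} j≮n with j <? n
  ... | yes j<n = contradiction j<n j≮n
  ... | no  _   = refl

  cappedPath : ∀ {n M} (f : ℕ → ℕ) → 0 < n → f 0 ≡ 0 → (∀ {i j} → i < j → f i < f j) →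
    (∀ j → j < n → f j < M) → Path n M
  cappedPath {n} {M} f 0<n f0≡0 f↑ f<M = record
    { index      = capped n M f
    ; start      = trans (capped-< 0<n) f0≡0
    ; end        = capped-≮ (n≮n n)
    ; increasing = increasing
    ; bounded    = bounded
    }
    where
    increasing : IncreasingUpTo n (capped n M f)
    increasing {i} {j} i<j j≤n with j <? n
    ... | yes _ = subst (_< f j) (sym (capped-< (<-≤-trans i<j j≤n))) (f↑ i<j)
    ... | no  _ = subst (_< M) (sym (capped-< (<-≤-trans i<j j≤n))) (f<M i (<-≤-trans i<j j≤n))
    bounded : ∀ j → capped n M f j ≤ M
    bounded j with j <? n
    ... | yes j<n = <⇒≤ (f<M j j<n)
    ... | no  _   = ≤-refl

  evenPath : ∀ {n M} → 0 < n → 2 * n ≤ M → Path n M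
  evenPath 0<n 2n≤M = cappedPath (2 *_) 0<n refl (*-monoʳ-< 2) (λ j j<n → <-≤-trans (*-monoʳ-< 2 j<n) 2n≤M)

  oddPath : ∀ {n M} → 0 < n → 2 * n ≤ M → Path n M
  oddPath 0<n 2n≤M = cappedPath oddIndex 0<n refl oddIndex-<
    (λ j j<n → ≤-<-trans (oddIndex≤2* j) (<-≤-trans (*-monoʳ-< 2 j<n) 2n≤M))
    where
    oddIndex-< : ∀ {i j} → i < j → oddIndex i < oddIndex j
    oddIndex-< {zero}  {suc j} _         = z<s
    oddIndex-< {suc i} {suc j} (s<s i<j) = s<s (*-monoʳ-< 2 i<j)
    oddIndex≤2* : ∀ j → oddIndex j ≤ 2 * j
    oddIndex≤2* zero    = z≤n
    oddIndex≤2* (suc j) = subst (suc (2 * j) ≤_) (sym (*-suc 2 j)) (n≤1+n _)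

  module Along {M} {b : ℕ → ℕ} (b↑ : IncreasingUpTo M b) where
    open Path

    along-increasing : ∀ {n} (P : Path n M) → IncreasingUpTo n (b ∘ index P)
    along-increasing P i<j j≤n = b↑ (increasing P i<j j≤n) (bounded P _)

    along-sum : ∀ {n d} (P : Path n M) (t : Fin d) →
      sumℕ {n} (λ i → chords (b ∘ index P) i t) ≡ chord (b 0) (b M) t
    along-sum P t =
      trans (chords-sum (along-increasing P) t) (cong₂ (λ u w → chord (b u) (b w) t) (start P) (end P))

    along-disjoint : ∀ {m n d} (P : Path m M) (Q : Path n M) (i : Fin m) (j : Fin n) →
      index P (suc (toℕ i)) ≢ index Q (suc (toℕ j)) →
      ¬ (chords {d = suc (suc d)} (b ∘ index P) i ≐ chords (b ∘ index Q) j)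
    along-disjoint P Q i j ends≢ same = ends≢ (increasing⇒injective b↑ (bounded P _) (bounded Q _)
      (chord-injectiveʳ (along-increasing P (n<1+n _) (toℕ<n i))
                        (along-increasing Q (n<1+n _) (toℕ<n j)) same))

open import Data.Nat.Properties using (≤-trans; m∸n≤m; m≤m+n; m≤n+m; n<1+n; *-monoʳ-≤; even≢odd)

mainTheorem1 : (d k ℓ r : ℕ) → 2 ≤ d → 1 ≤ k → 1 ≤ ℓ → 1 ≤ r →
  (c : Point d → Fin r) →
  Σ (Fin k → Point d) λ p → Σ (Fin ℓ → Point d) λ q → Σ (Fin r) λ col →
    ((∀ i → Positive (p i)) × (∀ j → Positive (q j))) ×
    ((∀ i → c (p i) ≡ col) × (∀ j → c (q j) ≡ col)) ×
    (∀ (t : Fin d) → sumℕ (λ i → p i t) ≡ sumℕ (λ j → q j t)) ×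
    (d ≤ k ∸ 1 → (f : Fin d → Fin k) → (∀ s → toℕ (f s) ≡ toℕ s) →
      LinIndepℚ (λ s → p (f s))) ×
    (d ≤ ℓ ∸ 1 → (g : Fin d → Fin ℓ) → (∀ s → toℕ (g s) ≡ toℕ s) →
      LinIndepℚ (λ s → q (g s))) ×
    (∀ (i : Fin k) (j : Fin ℓ) → suc (toℕ i) < k → suc (toℕ j) < ℓ →
      ¬ (p i ≐ q j))
mainTheorem1 (suc (suc d)) k ℓ (suc r) (s≤s (s≤s z≤n)) 0<k 0<ℓ _ c =
  chords (point ∘ index P) , chords (point ∘ index Q) , colour ,
  (chords-positive (along-increasing P) , chords-positive (along-increasing Q)) ,
  (chord-colour P , chord-colour Q) ,
  (λ t → trans (along-sum P t) (sym (along-sum Q t))) ,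
  (λ d≤k∸1 → chords-prefix-independent (≤-trans d≤k∸1 (m∸n≤m k 1)) (along-increasing P)) ,
  (λ d≤ℓ∸1 → chords-prefix-independent (≤-trans d≤ℓ∸1 (m∸n≤m ℓ 1)) (along-increasing Q)) ,
  λ i j i+1<k j+1<ℓ → along-disjoint P Q i j (λ same →
    even≢odd (suc (toℕ i)) (toℕ j) (trans (sym (capped-< i+1<k)) (trans same (capped-< j+1<ℓ))))
  where
  M = 2 * (k + ℓ)
  open Homogeneous (ramsey (λ u w → c (chord u w)) M)
  open Along increasing
  open Path using (index)
  P : Path k M
  P = evenPath 0<k (*-monoʳ-≤ 2 (m≤m+n k ℓ))
  Q : Path ℓ M
  Q = oddPath 0<ℓ (*-monoʳ-≤ 2 (m≤n+m ℓ k))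
  chord-colour : ∀ {n} (R : Path n M) (i : Fin n) → c (chords (point ∘ index R) i) ≡ colour
  chord-colour R i = monochromatic (Path.increasing R (n<1+n _) (toℕ<n i)) (Path.bounded R _)
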